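{- Let $G=(V,E)$ be a finite simple undirected graph with $E\neq\emptyset$, let $h$ be a positive integer, and let $\sup_{\min}(G,h)=\min\{\sup_G(e,h): e\in E\}$. Then for every positive integer $n$ and every edge $e\in E$, $H^{(n)}\mathrm{sup}(e)\ge \sup_{\min}(G,h)$, where $H^{(n)}\mathrm{sup}$ is the higher-order H-index sequence defined below.
   Context: $\mathrm{dist}_G$ is shortest-path distance in $G$. For a vertex $x$, $N_G(x,h)=\{y\neq x:\mathrm{dist}_G(x,y)\le h\}$. For an edge $e=(u,v)\in E$, the set of common $h$-neighbors is $\triangle_G(e,h)=N_G(u,h)\cap N_G(v,h)$ and the $h$-support is $\sup_G(e,h)=|\triangle_G(e,h)|$. For a finite multiset $M$ of nonnegative integers, $\mathcal{H}(M)$ is the largest integer $y\ge 0$ such that at least $y$ elements of $M$ are $\ge y$. Define $H^{(0)}\mathrm{sup}(e)=\sup_G(e,h)$ for all $e\in E$. For $n\ge 1$ and vertices $a,b$, let $P^{(n)}(a,b)=\max_{p}\min\{H^{(n-1)}\mathrm{sup}(f): f\text{ an edge of }p\}$, the maximum taken over all paths $p$ in $G$ from $a$ to $b$ with at most $h$ edges; and for $e=(u,v)\in E$ let $H^{(n)}\mathrm{sup}(e)=\mathcal{H}\big(\{\min(P^{(n)}(u,w),P^{(n)}(v,w)) : w\in\triangle_G(e,h)\}\big)$ (a multiset indexed by $w$). -}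

module Defs where

open import Data.Nat using (ℕ; zero; suc; _⊔_; _⊓_; _≤ᵇ_)
open import Data.Bool using (Bool; true; false; _∧_; _∨_; not; if_then_else_)
open import Data.Fin using (Fin)
open import Data.Fin.Properties using (_≟_)
open import Data.List using (List; []; _∷_; length; map; foldr; concatMap; allFin; upTo)
open import Data.Bool.ListAction using (any; all)

filterᵇ : ∀ {A : Set} → (A → Bool) → List A → List A
filterᵇ p []       = []
filterᵇ p (x ∷ xs) = if p x then x ∷ filterᵇ p xs else filterᵇ p xs
open import Data.Product using (_×_; _,_)
open import Relation.Nullary.Decidable using (⌊_⌋)
open import Relation.Binary.PropositionalEquality using (_≡_)

record Graph (k : ℕ) : Set where
  field
    adj    : Fin k → Fin k → Bool
    sym    : ∀ x y → adj x y ≡ adj y x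
    irrefl : ∀ x → adj x x ≡ false

open Graph public

module _ {k : ℕ} (G : Graph k) where

  eqᵇ : Fin k → Fin k → Bool
  eqᵇ x y = ⌊ x ≟ y ⌋

  -- within G h x y = true  iff  there is a walk from x to y with at most h edges,
  -- i.e.  dist_G(x,y) ≤ h.
  within : ℕ → Fin k → Fin k → Bool
  within zero    x y = eqᵇ x y
  within (suc h) x y = eqᵇ x y ∨ any (λ z → adj G x z ∧ within h z y) (allFin k)

  inNbhd : ℕ → Fin k → Fin k → Bool
  inNbhd h x y = not (eqᵇ x y) ∧ within h x y

  -- △_G(e,h) for e = (u,v), as the list of vertices (each vertex once)
  common : ℕ → Fin k → Fin k → List (Fin k)
  common h u v = filterᵇ (λ w → inNbhd h u w ∧ inNbhd h v w) (allFin k)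

  supp : ℕ → Fin k → Fin k → ℕ
  supp h u v = length (common h u v)

  -- list of edges (both orientations of each undirected edge)
  edges : List (Fin k × Fin k)
  edges = concatMap (λ u → map (λ v → (u , v))
                      (filterᵇ (λ v → adj G u v) (allFin k))) (allFin k)

  -- minimum of a list (0 for the empty list; only used for nonempty lists)
  minList : List ℕ → ℕ
  minList []       = 0
  minList (x ∷ xs) = foldr _⊓_ x xs

  maxList : List ℕ → ℕ
  maxList = foldr _⊔_ 0

  supMin : ℕ → ℕ
  supMin h = minList (map (λ { (u , v) → supp h u v }) edges)

countGe : ℕ → List ℕ → ℕ
countGe y M = length (filterᵇ (λ x → y ≤ᵇ x) M)

hAux : ℕ → List ℕ → ℕ
hAux zero    M = 0
hAux (suc y) M = if suc y ≤ᵇ countGe (suc y) M then suc y else hAux y M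

Hindex : List ℕ → ℕ
Hindex M = hAux (length M) M

module _ {k : ℕ} (G : Graph k) where

  seqs : ℕ → List (List (Fin k))
  seqs zero    = [] ∷ []
  seqs (suc l) = concatMap (λ x → map (x ∷_) (seqs l)) (allFin k)

  -- all vertex sequences with 1 .. (h+1) vertices
  seqsUpTo : ℕ → List (List (Fin k))
  seqsUpTo h = concatMap (λ l → seqs (suc l)) (upTo (suc h))

  distinctᵇ : List (Fin k) → Bool
  distinctᵇ []       = true
  distinctᵇ (x ∷ xs) = all (λ y → not (eqᵇ G x y)) xs ∧ distinctᵇ xs

  consecAdj : List (Fin k) → Bool
  consecAdj []           = true
  consecAdj (x ∷ [])     = true
  consecAdj (x ∷ y ∷ xs) = adj G x y ∧ consecAdj (y ∷ xs)

  headIs : Fin k → List (Fin k) → Bool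
  headIs a []      = false
  headIs a (x ∷ _) = eqᵇ G a x

  lastIs : Fin k → List (Fin k) → Bool
  lastIs b []           = false
  lastIs b (x ∷ [])     = eqᵇ G b x
  lastIs b (x ∷ y ∷ xs) = lastIs b (y ∷ xs)

  isPath : Fin k → Fin k → List (Fin k) → Bool
  isPath a b p = headIs a p ∧ lastIs b p ∧ consecAdj p ∧ distinctᵇ p

  pathEdges : List (Fin k) → List (Fin k × Fin k)
  pathEdges []           = []
  pathEdges (x ∷ [])     = []
  pathEdges (x ∷ y ∷ xs) = (x , y) ∷ pathEdges (y ∷ xs)

  -- P(a,b) = max over paths p from a to b with ≤ h edges of min of f over edges of p
  -- (max over no paths is 0)
  bottleneck : (Fin k → Fin k → ℕ) → ℕ → Fin k → Fin k → ℕ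
  bottleneck f h a b =
    maxList G (map (λ p → minList G (map (λ { (x , y) → f x y }) (pathEdges p)))
                   (filterᵇ (isPath a b) (seqsUpTo h)))

  Hsup : ℕ → ℕ → Fin k → Fin k → ℕ
  Hsup h zero    u v = supp G h u v
  Hsup h (suc n) u v =
    Hindex (map (λ w → P u w ⊓ P v w) (common G h u v))
    where
      P : Fin k → Fin k → ℕ
      P = bottleneck (Hsup h n) h

-- Induction on n, starting at n = 0 where the bound is the definition of sup_min. For the
-- step, take a common h-neighbour w of an edge (u, v). A walk of at most h edges from u to w
-- can be shortened, by cutting out the cycle at every repeated vertex, to a simple path of at
-- most h edges; every edge on it has H^(n)sup ≥ sup_min by induction, so P^(n+1)(u, w) ≥
-- sup_min, and likewise for v. Hence all sup(e, h) ≥ sup_min entries of the multiset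
-- defining H^(n+1)sup(e) are ≥ sup_min, and so is its H-index.
module Submission where

open import Defs
open import Data.Nat using (ℕ; _≤_; zero; suc; z≤n; s≤s; s≤s⁻¹; _≤ᵇ_)
open import Data.Nat.Properties
  using (≤-refl; ≤-reflexive; ≤-trans; m≤n⇒m≤1+n; ⊓-glb; m≤n⇒m⊓o≤n; m≤n⇒o⊓m≤n; m≤n⇒m≤o⊔n;
         m≤n⇒m≤n⊔o; m≤n⇒m<n∨m≡n; ≤⇒≤ᵇ; <⇒≤)
open import Data.Bool using (Bool; true; false; _∧_; not; T)
open import Data.Bool.Properties using (T-≡; ∧-conicalˡ; ∧-conicalʳ)
open import Data.Bool.ListAction using (any; all)
open import Data.Fin using (Fin)
open import Data.Fin.Properties using (_≟_)
open import Data.Empty using (⊥-elim)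
open import Data.Product using (∃; ∃₂; _×_; _,_)
open import Data.Sum using (inj₁; inj₂; [_,_])
open import Data.List using (List; []; _∷_; length; map; concatMap; allFin)
open import Data.List.Properties using (length-map; foldr-preservesᵇ; foldr-preservesᵒ)
open import Data.List.Relation.Unary.All using (All; []; _∷_)
import Data.List.Relation.Unary.All as All
open import Data.List.Relation.Unary.All.Properties using (map⁺)
open import Data.List.Relation.Unary.Any using (here; there)
import Data.List.Relation.Unary.Any as Any
open import Data.List.Relation.Unary.Any.Properties using (any⁻)
open import Data.List.Membership.Propositional using (_∈_; _∉_; lose)
open import Data.List.Membership.Propositional.Properties
  using (∈-map⁺; ∈-concatMap⁺; ∈-upTo⁺; ∈-allFin)
open import Function using (_∘_; Equivalence)
open import Relation.Nullary using (yes; no)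
open import Relation.Nullary.Decidable using (dec-true; dec-false; isYes≗does; toWitness)
open import Relation.Binary.PropositionalEquality using (_≡_; _≢_; refl; trans; cong; cong₂; subst)
import Relation.Binary.PropositionalEquality as ≡

private
  variable
    A : Set

∧-intro : ∀ {a b} → a ≡ true → b ≡ true → a ∧ b ≡ true
∧-intro = cong₂ _∧_

∧-elim : ∀ a {b} → a ∧ b ≡ true → a ≡ true × b ≡ true
∧-elim a e = ∧-conicalˡ a _ e , ∧-conicalʳ a _ e

T⇒≡true : ∀ {b} → T b → b ≡ true
T⇒≡true = Equivalence.to T-≡

any⇒∃ : (p : A → Bool) (xs : List A) → any p xs ≡ true → ∃ λ x → p x ≡ true
any⇒∃ p xs e =
  let (x , px) = Any.satisfied (any⁻ p xs (Equivalence.from T-≡ e)) in x , T⇒≡true px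

filterᵇ-∈ : (p : A → Bool) {x : A} {xs : List A} → x ∈ xs → p x ≡ true → x ∈ filterᵇ p xs
filterᵇ-∈ p {xs = y ∷ ys} (here refl) px rewrite px = here refl
filterᵇ-∈ p {xs = y ∷ ys} (there x∈ys) px with p y
... | true  = there (filterᵇ-∈ p x∈ys px)
... | false = filterᵇ-∈ p x∈ys px

All-filterᵇ : (p : A → Bool) (xs : List A) → All (λ x → p x ≡ true) (filterᵇ p xs)
All-filterᵇ p []       = []
All-filterᵇ p (x ∷ xs) with p x in px
... | true  = px ∷ All-filterᵇ p xs
... | false = All-filterᵇ p xs

filterᵇ-all : (p : A → Bool) {xs : List A} → All (λ x → p x ≡ true) xs → filterᵇ p xs ≡ xs
filterᵇ-all p []                = refl
filterᵇ-all p (_∷_ {x} px pxs) rewrite px = cong (x ∷_) (filterᵇ-all p pxs)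

countGe-all : ∀ {y} M → All (y ≤_) M → countGe y M ≡ length M
countGe-all M y≤M = cong length (filterᵇ-all _ (All.map (T⇒≡true ∘ ≤⇒≤ᵇ) y≤M))

hAux-≥ : ∀ {y} b M → y ≤ b → y ≤ countGe y M → y ≤ hAux b M
hAux-≥ zero    M z≤n _ = z≤n
hAux-≥ (suc b) M y≤1+b y≤count with suc b ≤ᵇ countGe (suc b) M in test
... | true  = y≤1+b
... | false with m≤n⇒m<n∨m≡n y≤1+b
...   | inj₁ y<1+b = hAux-≥ b M (s≤s⁻¹ y<1+b) y≤count
...   | inj₂ refl  = ⊥-elim (subst T test (≤⇒≤ᵇ y≤count))

Hindex-≥ : ∀ {s} M → All (s ≤_) M → s ≤ length M → s ≤ Hindex M
Hindex-≥ {s} M s≤M s≤len =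
  hAux-≥ (length M) M s≤len (subst (s ≤_) (≡.sym (countGe-all M s≤M)) s≤len)

module _ {k : ℕ} (G : Graph k) where

  minList-≤ : ∀ {x} xs → x ∈ xs → minList G xs ≤ x
  minList-≤ (y ∷ ys) x∈xs =
    foldr-preservesᵒ (λ a b → [ m≤n⇒m⊓o≤n b , m≤n⇒o⊓m≤n a ]) y ys
      (Any.toSum (Any.map (≤-reflexive ∘ ≡.sym) x∈xs))

  minList-glb : ∀ {s x xs} → All (s ≤_) (x ∷ xs) → s ≤ minList G (x ∷ xs)
  minList-glb (s≤x ∷ s≤xs) = foldr-preservesᵇ ⊓-glb s≤x s≤xs

  maxList-≥ : ∀ {x} xs → x ∈ xs → x ≤ maxList G xs
  maxList-≥ xs x∈xs =
    foldr-preservesᵒ (λ a b → [ m≤n⇒m≤n⊔o b , m≤n⇒m≤o⊔n a ]) 0 xs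
      (inj₂ (Any.map ≤-reflexive x∈xs))

  open import Data.List.Membership.DecPropositional (_≟_ {k}) using (_∈?_)

  eqᵇ-refl : ∀ x → eqᵇ G x x ≡ true
  eqᵇ-refl x = trans (isYes≗does (x ≟ x)) (dec-true (x ≟ x) refl)

  ≢⇒eqᵇ≡false : ∀ {x y} → x ≢ y → eqᵇ G x y ≡ false
  ≢⇒eqᵇ≡false {x} {y} x≢y = trans (isYes≗does (x ≟ y)) (dec-false (x ≟ y) x≢y)

  eqᵇ⇒≡ : ∀ {x y} → eqᵇ G x y ≡ true → x ≡ y
  eqᵇ⇒≡ {x} {y} e = toWitness {a? = x ≟ y} (Equivalence.from T-≡ e)

  inNbhd⇒≢ : ∀ {h a b} → inNbhd G h a b ≡ true → a ≢ b
  inNbhd⇒≢ {a = a} {b} a~b a≡b with a ≟ b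
  ... | no a≢b = a≢b a≡b
  ... | yes _ with () ← a~b

  ∉⇒freshᵇ : ∀ {x xs} → x ∉ xs → all (λ w → not (eqᵇ G x w)) xs ≡ true
  ∉⇒freshᵇ {xs = []}         _   = refl
  ∉⇒freshᵇ {x} {xs = w ∷ ws} x∉ rewrite ≢⇒eqᵇ≡false {x} {w} (x∉ ∘ here) = ∉⇒freshᵇ (x∉ ∘ there)

  record SimplePath (h : ℕ) (x y : Fin k) : Set where
    constructor simplePath
    field
      rest     : List (Fin k)
      ends     : lastIs G y (x ∷ rest) ≡ true
      adjacent : consecAdj G (x ∷ rest) ≡ true
      distinct : distinctᵇ G (x ∷ rest) ≡ true
      short    : length rest ≤ h

  open SimplePath

  trivialPath : ∀ {h} x → SimplePath h x x
  trivialPath x = simplePath [] (eqᵇ-refl x) refl refl z≤n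

  weakenPath : ∀ {h x y} → SimplePath h x y → SimplePath (suc h) x y
  weakenPath (simplePath r e a d l) = simplePath r e a d (m≤n⇒m≤1+n l)

  suffixPath : ∀ {h x y z} (p : SimplePath h z y) → x ∈ z ∷ rest p → SimplePath h x y
  suffixPath p (here refl) = p
  suffixPath {z = z} (simplePath (z′ ∷ r) e a d l) (there x∈p) =
    suffixPath (simplePath r e (∧-conicalʳ _ _ a) d′ (<⇒≤ l)) x∈p
    where d′ = ∧-conicalʳ (all (λ w → not (eqᵇ G z w)) (z′ ∷ r)) _ d

  consPath : ∀ {h x y z} → adj G x z ≡ true → SimplePath h z y → SimplePath (suc h) x y
  consPath {x = x} {z = z} x~z p with x ∈? z ∷ rest p
  ... | yes x∈p = weakenPath (suffixPath p x∈p)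
  ... | no  x∉p = simplePath (z ∷ rest p) (ends p) (∧-intro x~z (adjacent p))
                    (∧-intro (∉⇒freshᵇ x∉p) (distinct p)) (s≤s (short p))

  within⇒SimplePath : ∀ h {x y} → within G h x y ≡ true → SimplePath h x y
  within⇒SimplePath zero e with refl ← eqᵇ⇒≡ e = trivialPath _
  within⇒SimplePath (suc h) {x} {y} e with eqᵇ G x y in x=y
  ... | true with refl ← eqᵇ⇒≡ x=y = trivialPath x
  ... | false =
    let (z , step) = any⇒∃ _ (allFin k) e
    in consPath (∧-conicalˡ _ _ step) (within⇒SimplePath h (∧-conicalʳ _ _ step))

  seqs-∈ : ∀ p → p ∈ seqs G (length p)
  seqs-∈ []      = here refl
  seqs-∈ (x ∷ p) = ∈-concatMap⁺ _ (lose (∈-allFin x) (∈-map⁺ (x ∷_) (seqs-∈ p)))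

  seqsUpTo-∈ : ∀ {h} x r → length r ≤ h → (x ∷ r) ∈ seqsUpTo G h
  seqsUpTo-∈ x r r≤h = ∈-concatMap⁺ _ (lose (∈-upTo⁺ (s≤s r≤h)) (seqs-∈ (x ∷ r)))

  SimplePath-∈ : ∀ {h a b} (p : SimplePath h a b)
               → (a ∷ rest p) ∈ filterᵇ (isPath G a b) (seqsUpTo G h)
  SimplePath-∈ {a = a} (simplePath r e c d l) =
    filterᵇ-∈ _ (seqsUpTo-∈ a r l) (∧-intro (eqᵇ-refl a) (∧-intro e (∧-intro c d)))

  All-pathEdges : ∀ {P : Fin k × Fin k → Set} → (∀ {a b} → adj G a b ≡ true → P (a , b))
                → ∀ p → consecAdj G p ≡ true → All P (pathEdges G p)
  All-pathEdges P-adj []          _   = []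
  All-pathEdges P-adj (_ ∷ [])    _   = []
  All-pathEdges P-adj (a ∷ b ∷ p) c =
    P-adj (∧-conicalˡ _ _ c) ∷ All-pathEdges P-adj (b ∷ p) (∧-conicalʳ _ _ c)

  bottleneck-≥ : ∀ {s} (f : Fin k → Fin k → ℕ) → (∀ {a b} → adj G a b ≡ true → s ≤ f a b)
               → ∀ h {a b} → inNbhd G h a b ≡ true → s ≤ bottleneck G f h a b
  bottleneck-≥ f s≤f h {a} a~b with within⇒SimplePath h (∧-conicalʳ _ _ a~b)
  ... | simplePath [] b=a _ _ _ = ⊥-elim (inNbhd⇒≢ {h} a~b (≡.sym (eqᵇ⇒≡ b=a)))
  ... | p@(simplePath (z ∷ r) _ c _ _) =
    ≤-trans (minList-glb (map⁺ (All-pathEdges s≤f (a ∷ z ∷ r) c)))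
            (maxList-≥ _ (∈-map⁺ _ (SimplePath-∈ p)))

  supMin≤supp : ∀ h {u v} → adj G u v ≡ true → supMin G h ≤ supp G h u v
  supMin≤supp h {u} {v} u~v =
    minList-≤ _ (∈-map⁺ _ (∈-concatMap⁺ _ (lose (∈-allFin u) uv∈edges)))
    where uv∈edges = ∈-map⁺ (u ,_) (filterᵇ-∈ _ (∈-allFin v) u~v)

  All-common : ∀ h u v
             → All (λ w → inNbhd G h u w ≡ true × inNbhd G h v w ≡ true) (common G h u v)
  All-common h u v = All.map (λ {w} → ∧-elim (inNbhd G h u w)) (All-filterᵇ _ (allFin k))

  supMin≤Hsup : ∀ h n {u v} → adj G u v ≡ true → supMin G h ≤ Hsup G h n u v
  supMin≤Hsup h zero    u~v = supMin≤supp h u~v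
  supMin≤Hsup h (suc n) {u} {v} u~v =
    Hindex-≥ _ (map⁺ (All.map (λ (u~w , v~w) → ⊓-glb (P≥ u~w) (P≥ v~w)) (All-common h u v)))
      (subst (supMin G h ≤_) (≡.sym (length-map _ (common G h u v))) (supMin≤supp h u~v))
    where
    P≥ : ∀ {a b} → inNbhd G h a b ≡ true → supMin G h ≤ bottleneck G (Hsup G h n) h a b
    P≥ = bottleneck-≥ (Hsup G h n) (supMin≤Hsup h n) h

lemma3 : ∀ {k : ℕ} (G : Graph k) (h : ℕ) → 1 ≤ h
         → ∃₂ (λ (x y : Fin k) → adj G x y ≡ true)
         → ∀ (n : ℕ) → 1 ≤ n
         → ∀ (u v : Fin k) → adj G u v ≡ true
         → supMin G h ≤ Hsup G h n u v
lemma3 G h _ _ n _ u v u~v = supMin≤Hsup G h n u~v
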